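{- For every nonzero Gaussian integer $\alpha\in\mathbb{Z}[i]$, \[ ||\alpha||_4\le 7\log_2|\alpha|+5 . \]
   Context: An expression is a formal term built from the symbol $x$ using the binary operations $+$ and $\cdot$ (with parentheses); its size is the number of occurrences of $x$ in it. For $\alpha\in\mathbb{Z}[i]$, $||\alpha||_4$ is the minimum size of an expression which evaluates to $\alpha$ when $x=i$ ($i=\zeta_4=e^{2\pi i/4}$). $|\alpha|$ is the complex absolute value. -}

module Defs where

open import Data.Nat using (ℕ; _+_; _≤_)
open import Data.Integer as ℤ using (ℤ; +_; ∣_∣)
open import Data.Product using (Σ; _×_)
open import Relation.Binary.PropositionalEquality using (_≡_)

record ℤ[i] : Set where
  constructor _+_i
  field
    re : ℤ
    im : ℤ
open ℤ[i] public

infixl 6 _⊕_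
infixl 7 _⊗_

_⊕_ : ℤ[i] → ℤ[i] → ℤ[i]
(a + b i) ⊕ (c + d i) = (a ℤ.+ c) + (b ℤ.+ d) i

_⊗_ : ℤ[i] → ℤ[i] → ℤ[i]
(a + b i) ⊗ (c + d i) = (a ℤ.* c ℤ.- b ℤ.* d) + (a ℤ.* d ℤ.+ b ℤ.* c) i

0ᵍ : ℤ[i]
0ᵍ = (+ 0) + (+ 0) i

iᵍ : ℤ[i]
iᵍ = (+ 0) + (+ 1) i

normᵍ : ℤ[i] → ℕ
normᵍ α = ∣ re α ℤ.* re α ℤ.+ im α ℤ.* im α ∣

data Expr : Set where
  x   : Expr
  _⊞_ : Expr → Expr → Expr
  _⊡_ : Expr → Expr → Expr

size : Expr → ℕ
size x       = 1
size (e ⊞ f) = size e + size f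
size (e ⊡ f) = size e + size f

eval : Expr → ℤ[i]
eval x       = iᵍ
eval (e ⊞ f) = eval e ⊕ eval f
eval (e ⊡ f) = eval e ⊗ eval f

IsComplexity₄ : ℤ[i] → ℕ → Set
IsComplexity₄ α n =
  Σ Expr (λ e → eval e ≡ α × size e ≡ n)
  × ((e : Expr) → eval e ≡ α → n ≤ size e)

{-# OPTIONS --safe #-}
-- Balanced binary expansion in base 2i.  Writing re α = r + 2c and im α = s + 2d with
-- r, s ∈ {-1, 0, 1}, 2|c| ≤ |re α| and 2|d| ≤ |im α| gives α = 2i·β + (r + s i) with
-- β = d − c i and 4 N(β) ≤ N(α).  As 2i = x + x has size 2 and every nonzero digit
-- r + s i has an expression of size at most 5, each step costs at most 7 while dividing
-- the norm by at least 4.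
module Submission where

open import Defs
open import Data.Nat as ℕ using (ℕ; zero; suc; _≤_; _<_; _^_; _∸_; z≤n; s≤s; NonZero)
open import Data.Nat.Properties
open import Data.Nat.Induction using (<-wellFounded)
open import Data.Integer as ℤ using (ℤ; +_; -[1+_]; ∣_∣; +0)
import Data.Integer.Properties as ℤ
open import Data.Integer.Tactic.RingSolver using (solve-∀)
import Data.Nat.Tactic.RingSolver as NatSolver
open import Data.Product using (Σ; _×_; _,_)
open import Data.Sum using (_⊎_; inj₁; inj₂)
open import Data.Empty using (⊥-elim)
open import Induction.WellFounded using (module All)
open import Relation.Binary.Construct.On as On using ()
open import Relation.Binary.Definitions using (DecidableEquality)
open import Relation.Binary.PropositionalEquality
  using (_≡_; _≢_; refl; sym; trans; cong; cong₂; subst; module ≡-Reasoning)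
open import Relation.Nullary using (¬_; yes; no)
open import Relation.Nullary.Decidable using (map′; _×-dec_)

data Digit : Set where
  -1ᵈ 0ᵈ +1ᵈ : Digit

⟦_⟧ᵈ : Digit → ℤ
⟦ -1ᵈ ⟧ᵈ = ℤ.- + 1
⟦ 0ᵈ ⟧ᵈ  = + 0
⟦ +1ᵈ ⟧ᵈ = + 1

negateᵈ : Digit → Digit
negateᵈ -1ᵈ = +1ᵈ
negateᵈ 0ᵈ  = 0ᵈ
negateᵈ +1ᵈ = -1ᵈ

⟦negateᵈ⟧ : ∀ r → ⟦ negateᵈ r ⟧ᵈ ≡ ℤ.- ⟦ r ⟧ᵈ
⟦negateᵈ⟧ -1ᵈ = refl
⟦negateᵈ⟧ 0ᵈ  = refl
⟦negateᵈ⟧ +1ᵈ = refl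

record Halving (a : ℤ) : Set where
  constructor halving
  field
    digit      : Digit
    half       : ℤ
    split      : a ≡ ⟦ digit ⟧ᵈ ℤ.+ (half ℤ.+ half)
    half-bound : ∣ half ∣ ℕ.+ ∣ half ∣ ≤ ∣ a ∣

halve-+ : (n : ℕ) → Halving (+ n)
halve-+ 0 = halving 0ᵈ +0 refl z≤n
halve-+ 1 = halving +1ᵈ +0 refl z≤n
halve-+ (suc (suc n)) with halve-+ n
... | halving r c split bound = halving r (c ℤ.+ + 1) split′ bound′
  where
  split′ : + suc (suc n) ≡ ⟦ r ⟧ᵈ ℤ.+ ((c ℤ.+ + 1) ℤ.+ (c ℤ.+ + 1))
  split′ = trans (cong (ℤ._+_ (+ 2)) split) (identity ⟦ r ⟧ᵈ c)
    where
    identity : ∀ r c → + 2 ℤ.+ (r ℤ.+ (c ℤ.+ c)) ≡ r ℤ.+ ((c ℤ.+ + 1) ℤ.+ (c ℤ.+ + 1))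
    identity = solve-∀

  ∣c+1∣≤1+∣c∣ : ∣ c ℤ.+ + 1 ∣ ≤ suc ∣ c ∣
  ∣c+1∣≤1+∣c∣ = subst (∣ c ℤ.+ + 1 ∣ ≤_) (+-comm ∣ c ∣ 1) (ℤ.∣i+j∣≤∣i∣+∣j∣ c (+ 1))

  bound′ : ∣ c ℤ.+ + 1 ∣ ℕ.+ ∣ c ℤ.+ + 1 ∣ ≤ suc (suc n)
  bound′ = begin
    ∣ c ℤ.+ + 1 ∣ ℕ.+ ∣ c ℤ.+ + 1 ∣ ≤⟨ +-mono-≤ ∣c+1∣≤1+∣c∣ ∣c+1∣≤1+∣c∣ ⟩
    suc ∣ c ∣ ℕ.+ suc ∣ c ∣          ≡⟨ cong suc (+-suc ∣ c ∣ ∣ c ∣) ⟩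
    suc (suc (∣ c ∣ ℕ.+ ∣ c ∣))      ≤⟨ s≤s (s≤s bound) ⟩
    suc (suc n)                      ∎
    where open ≤-Reasoning

halve-negate : ∀ {a} → Halving a → Halving (ℤ.- a)
halve-negate {a} (halving r c split bound) = halving (negateᵈ r) (ℤ.- c) split′ bound′
  where
  split′ : ℤ.- a ≡ ⟦ negateᵈ r ⟧ᵈ ℤ.+ (ℤ.- c ℤ.+ ℤ.- c)
  split′ = begin
    ℤ.- a                                  ≡⟨ cong ℤ.-_ split ⟩
    ℤ.- (⟦ r ⟧ᵈ ℤ.+ (c ℤ.+ c))             ≡⟨ identity ⟦ r ⟧ᵈ c ⟩
    ℤ.- ⟦ r ⟧ᵈ ℤ.+ (ℤ.- c ℤ.+ ℤ.- c)       ≡⟨ cong (ℤ._+ (ℤ.- c ℤ.+ ℤ.- c)) (sym (⟦negateᵈ⟧ r)) ⟩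
    ⟦ negateᵈ r ⟧ᵈ ℤ.+ (ℤ.- c ℤ.+ ℤ.- c)   ∎
    where
    open ≡-Reasoning
    identity : ∀ r c → ℤ.- (r ℤ.+ (c ℤ.+ c)) ≡ ℤ.- r ℤ.+ (ℤ.- c ℤ.+ ℤ.- c)
    identity = solve-∀

  bound′ : ∣ ℤ.- c ∣ ℕ.+ ∣ ℤ.- c ∣ ≤ ∣ ℤ.- a ∣
  bound′ rewrite ℤ.∣-i∣≡∣i∣ c | ℤ.∣-i∣≡∣i∣ a = bound

halve : (a : ℤ) → Halving a
halve (+ n)    = halve-+ n
halve -[1+ n ] = halve-negate (halve-+ (suc n))

i*i≡+∣i∣*∣i∣ : ∀ i → i ℤ.* i ≡ + (∣ i ∣ ℕ.* ∣ i ∣)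
i*i≡+∣i∣*∣i∣ (+ zero)  = refl
i*i≡+∣i∣*∣i∣ (+ suc n) = refl
i*i≡+∣i∣*∣i∣ -[1+ n ] = refl

normᵍ≡ : ∀ a b → normᵍ (a + b i) ≡ ∣ a ∣ ℕ.* ∣ a ∣ ℕ.+ ∣ b ∣ ℕ.* ∣ b ∣
normᵍ≡ a b rewrite i*i≡+∣i∣*∣i∣ a | i*i≡+∣i∣*∣i∣ b = refl

normᵍ-pos : ∀ {α} → α ≢ 0ᵍ → 0 < normᵍ α
normᵍ-pos {+0 + +0 i}             α≢0 = ⊥-elim (α≢0 refl)
normᵍ-pos {+0 + (+ suc n) i}       _   = s≤s z≤n
normᵍ-pos {+0 + -[1+ n ] i}        _   = s≤s z≤n
normᵍ-pos {(+ suc n) + b i}        _   rewrite normᵍ≡ (+ suc n) b = s≤s z≤n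
normᵍ-pos { -[1+ n ] + b i}        _   rewrite normᵍ≡ -[1+ n ] b = s≤s z≤n

_≟ᵍ_ : DecidableEquality ℤ[i]
(a + b i) ≟ᵍ (c + d i) =
  map′ (λ (a≡c , b≡d) → cong₂ _+_i a≡c b≡d) (λ eq → cong re eq , cong im eq)
       ((a ℤ.≟ c) ×-dec (b ℤ.≟ d))

⊕-identityˡ : ∀ α → 0ᵍ ⊕ α ≡ α
⊕-identityˡ (a + b i) = cong₂ _+_i (ℤ.+-identityˡ a) (ℤ.+-identityˡ b)

⊕-identityʳ : ∀ α → α ⊕ 0ᵍ ≡ α
⊕-identityʳ (a + b i) = cong₂ _+_i (ℤ.+-identityʳ a) (ℤ.+-identityʳ b)

2iᵍ : ℤ[i]
2iᵍ = +0 + (+ 2) i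

digitᵍ : Digit → Digit → ℤ[i]
digitᵍ r s = ⟦ r ⟧ᵈ + ⟦ s ⟧ᵈ i

record GaussianHalving (α : ℤ[i]) : Set where
  constructor gaussian-halving
  field
    re-digit im-digit : Digit
    quotient          : ℤ[i]
    split             : α ≡ 2iᵍ ⊗ quotient ⊕ digitᵍ re-digit im-digit
    quotient-norm     : 4 ℕ.* normᵍ quotient ≤ normᵍ α

4*normᵍ[d-ci]≤normᵍ[a+bi] : ∀ c d a b → ∣ c ∣ ℕ.+ ∣ c ∣ ≤ ∣ a ∣ → ∣ d ∣ ℕ.+ ∣ d ∣ ≤ ∣ b ∣ →
                      4 ℕ.* normᵍ (d + (ℤ.- c) i) ≤ normᵍ (a + b i)
4*normᵍ[d-ci]≤normᵍ[a+bi] c d a b c-bound d-bound = begin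
  4 ℕ.* normᵍ (d + (ℤ.- c) i)                              ≡⟨ cong (4 ℕ.*_) (normᵍ≡ d (ℤ.- c)) ⟩
  4 ℕ.* (∣ d ∣ ℕ.* ∣ d ∣ ℕ.+ ∣ ℤ.- c ∣ ℕ.* ∣ ℤ.- c ∣)     ≡⟨ cong (λ m → 4 ℕ.* (∣ d ∣ ℕ.* ∣ d ∣ ℕ.+ m ℕ.* m)) (ℤ.∣-i∣≡∣i∣ c) ⟩
  4 ℕ.* (∣ d ∣ ℕ.* ∣ d ∣ ℕ.+ ∣ c ∣ ℕ.* ∣ c ∣)             ≡⟨ identity ∣ c ∣ ∣ d ∣ ⟩
  (∣ c ∣ ℕ.+ ∣ c ∣) ℕ.* (∣ c ∣ ℕ.+ ∣ c ∣) ℕ.+ (∣ d ∣ ℕ.+ ∣ d ∣) ℕ.* (∣ d ∣ ℕ.+ ∣ d ∣)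
    ≤⟨ +-mono-≤ (*-mono-≤ c-bound c-bound) (*-mono-≤ d-bound d-bound) ⟩
  ∣ a ∣ ℕ.* ∣ a ∣ ℕ.+ ∣ b ∣ ℕ.* ∣ b ∣                     ≡⟨ normᵍ≡ a b ⟨
  normᵍ (a + b i)                                        ∎
  where
  open ≤-Reasoning
  identity : ∀ u v → 4 ℕ.* (v ℕ.* v ℕ.+ u ℕ.* u) ≡ (u ℕ.+ u) ℕ.* (u ℕ.+ u) ℕ.+ (v ℕ.+ v) ℕ.* (v ℕ.+ v)
  identity = NatSolver.solve-∀

halveᵍ : (α : ℤ[i]) → GaussianHalving α
halveᵍ (a + b i) with halve a | halve b
... | halving r c a-split c-bound | halving s d b-split d-bound =
  gaussian-halving r s (d + (ℤ.- c) i)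
    (cong₂ _+_i (trans a-split (re-identity ⟦ r ⟧ᵈ c d)) (trans b-split (im-identity ⟦ s ⟧ᵈ c d)))
    (4*normᵍ[d-ci]≤normᵍ[a+bi] c d a b c-bound d-bound)
  where
  re-identity : ∀ r c d → r ℤ.+ (c ℤ.+ c) ≡ + 0 ℤ.* d ℤ.- + 2 ℤ.* ℤ.- c ℤ.+ r
  re-identity = solve-∀
  im-identity : ∀ s c d → s ℤ.+ (d ℤ.+ d) ≡ + 0 ℤ.* ℤ.- c ℤ.+ + 2 ℤ.* d ℤ.+ s
  im-identity = solve-∀

ExpressibleWithin : ℤ[i] → ℕ → Set
ExpressibleWithin α k = Σ Expr λ e → eval e ≡ α × size e ≤ k

complexity≤expressible : ∀ {α k} → IsComplexity₄ α k → ∀ {m} → ExpressibleWithin α m → k ≤ m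
complexity≤expressible (_ , minimal) (e , eval-e , size-e) = ≤-trans (minimal e eval-e) size-e

digit-zero-or-expressible : ∀ r s → digitᵍ r s ≡ 0ᵍ ⊎ ExpressibleWithin (digitᵍ r s) 5
digit-zero-or-expressible 0ᵈ  0ᵈ  = inj₁ refl
digit-zero-or-expressible 0ᵈ  +1ᵈ = inj₂ (x , refl , s≤s z≤n)
digit-zero-or-expressible -1ᵈ 0ᵈ  = inj₂ (x ⊡ x , refl , s≤s (s≤s z≤n))
digit-zero-or-expressible 0ᵈ  -1ᵈ = inj₂ ((x ⊡ x) ⊡ x , refl , s≤s (s≤s (s≤s z≤n)))
digit-zero-or-expressible +1ᵈ 0ᵈ  = inj₂ ((x ⊡ x) ⊡ (x ⊡ x) , refl , s≤s (s≤s (s≤s (s≤s z≤n))))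
digit-zero-or-expressible -1ᵈ +1ᵈ = inj₂ (x ⊞ (x ⊡ x) , refl , s≤s (s≤s (s≤s z≤n)))
digit-zero-or-expressible -1ᵈ -1ᵈ = inj₂ (x ⊡ (x ⊞ (x ⊡ x)) , refl , s≤s (s≤s (s≤s (s≤s z≤n))))
digit-zero-or-expressible +1ᵈ +1ᵈ = inj₂ (((x ⊡ x) ⊡ (x ⊡ x)) ⊞ x , refl , ≤-refl)
digit-zero-or-expressible +1ᵈ -1ᵈ = inj₂ ((x ⊡ x) ⊡ (x ⊞ (x ⊡ x)) , refl , ≤-refl)

expressible-2i*+digit : ∀ {β k} → ExpressibleWithin β k →
                        ∀ r s → ExpressibleWithin (2iᵍ ⊗ β ⊕ digitᵍ r s) (7 ℕ.+ k)
expressible-2i*+digit {β} {k} (e , refl , size-e) r s with digit-zero-or-expressible r s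
... | inj₁ ρ≡0 =
  (x ⊞ x) ⊡ e ,
  trans (sym (⊕-identityʳ (2iᵍ ⊗ β))) (cong (2iᵍ ⊗ β ⊕_) (sym ρ≡0)) ,
  ≤-trans (+-monoʳ-≤ 2 size-e) (m≤n+m (2 ℕ.+ k) 5)
... | inj₂ (d , eval-d , size-d) =
  ((x ⊞ x) ⊡ e) ⊞ d ,
  cong (2iᵍ ⊗ β ⊕_) eval-d ,
  ≤-trans (+-mono-≤ (+-monoʳ-≤ 2 size-e) size-d) (≤-reflexive (+-comm (2 ℕ.+ k) 5))

m+n∸o≤m+[n∸o] : ∀ m n o → m ℕ.+ n ∸ o ≤ m ℕ.+ (n ∸ o)
m+n∸o≤m+[n∸o] m n       zero    = ≤-refl
m+n∸o≤m+[n∸o] m zero    (suc o) rewrite +-identityʳ m = m∸n≤m m (suc o)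
m+n∸o≤m+[n∸o] m (suc n) (suc o) rewrite +-suc m n = m+n∸o≤m+[n∸o] m n o

^-distribʳ-* : ∀ m n k → (m ℕ.* n) ^ k ≡ m ^ k ℕ.* n ^ k
^-distribʳ-* m n zero    = refl
^-distribʳ-* m n (suc k) = begin
  m ℕ.* n ℕ.* (m ℕ.* n) ^ k         ≡⟨ cong (m ℕ.* n ℕ.*_) (^-distribʳ-* m n k) ⟩
  m ℕ.* n ℕ.* (m ^ k ℕ.* n ^ k)     ≡⟨ *-interchange m n (m ^ k) (n ^ k) ⟩
  m ℕ.* m ^ k ℕ.* (n ℕ.* n ^ k)     ∎
  where
  open ≡-Reasoning
  open import Algebra.Properties.CommutativeSemigroup *-commutativeSemigroup
    using () renaming (interchange to *-interchange)

budget-step : ∀ b c e k m n .{{_ : NonZero b}} →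
              b ^ (k ∸ c) ≤ m ^ e → b ℕ.* m ≤ n → b ^ (e ℕ.+ k ∸ c) ≤ n ^ e
budget-step b c e k m n previous bm≤n = begin
  b ^ (e ℕ.+ k ∸ c)        ≤⟨ ^-monoʳ-≤ b (m+n∸o≤m+[n∸o] e k c) ⟩
  b ^ (e ℕ.+ (k ∸ c))      ≡⟨ ^-distribˡ-+-* b e (k ∸ c) ⟩
  b ^ e ℕ.* b ^ (k ∸ c)    ≤⟨ *-monoʳ-≤ (b ^ e) previous ⟩
  b ^ e ℕ.* m ^ e          ≡⟨ ^-distribʳ-* b m e ⟨
  (b ℕ.* m) ^ e            ≤⟨ ^-monoˡ-≤ e bm≤n ⟩
  n ^ e                    ∎
  where open ≤-Reasoning

WithinBound : ℤ[i] → Set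
WithinBound α = Σ ℕ λ k → ExpressibleWithin α k × 4 ^ (k ∸ 5) ≤ normᵍ α ^ 7

nonzero-digit-within-bound : ∀ r s → digitᵍ r s ≢ 0ᵍ → WithinBound (digitᵍ r s)
nonzero-digit-within-bound r s ρ≢0 with digit-zero-or-expressible r s
... | inj₁ ρ≡0       = ⊥-elim (ρ≢0 ρ≡0)
... | inj₂ expressed = 5 , expressed , ^-monoˡ-≤ 7 (normᵍ-pos ρ≢0)

within-bound : (α : ℤ[i]) → α ≢ 0ᵍ → WithinBound α
within-bound = All.wfRec (On.wellFounded normᵍ <-wellFounded) _ (λ α → α ≢ 0ᵍ → WithinBound α) step
  where
  step : ∀ α → (∀ {β} → normᵍ β < normᵍ α → β ≢ 0ᵍ → WithinBound β) → α ≢ 0ᵍ → WithinBound α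
  step α rec α≢0 with halveᵍ α
  ... | gaussian-halving r s β refl β-norm with β ≟ᵍ 0ᵍ
  ...   | yes refl =
    -- here α is 2iᵍ ⊗ 0ᵍ ⊕ digitᵍ r s, and 2iᵍ ⊗ 0ᵍ computes to 0ᵍ
    subst WithinBound (sym (⊕-identityˡ (digitᵍ r s)))
          (nonzero-digit-within-bound r s (λ ρ≡0 → α≢0 (trans (⊕-identityˡ (digitᵍ r s)) ρ≡0)))
  ...   | no β≢0 =
    let k , expressed , bound = rec β-smaller β≢0
    in  7 ℕ.+ k , expressible-2i*+digit expressed r s , budget-step 4 5 7 k (normᵍ β) _ bound β-norm
    where
    β-smaller : normᵍ β < normᵍ α
    -- 4 * N unfolds to N + (N + (N + (N + 0)))
    β-smaller = <-≤-trans (m<m+n (normᵍ β) (≤-trans (normᵍ-pos β≢0) (m≤m+n _ _))) β-norm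

proposition2p5 : (α : ℤ[i]) → ¬ (α ≡ 0ᵍ) → (n : ℕ) → IsComplexity₄ α n →
    4 ^ (n ∸ 5) ≤ normᵍ α ^ 7
proposition2p5 α α≢0 n complexity =
  let k , expressed , bound = within-bound α α≢0
  in  ≤-trans (^-monoʳ-≤ 4 (∸-monoˡ-≤ 5 (complexity≤expressible complexity expressed))) bound
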